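{- Let $d\geq 0$ and $0<i\leq d+1$ be integers, and let $\Delta$ be a $d$-dimensional simplicial complex with $\tilde{H}_d(\Delta;\mathbb{Z})\neq 0$ and with no missing faces of dimension $>i$. If $F\in\Delta$ is a face with $\tilde{H}_d(\operatorname{ast}(F,\Delta);\mathbb{Z})=0$, then $\tilde{H}_{d-|F|}(\operatorname{lk}(F,\Delta);\mathbb{Z})\neq 0$.
   Context: A set $F$ of vertices is a missing face of $\Delta$ if $F\notin\Delta$ but every proper subset of $F$ is in $\Delta$; its dimension is $|F|-1$. $\tilde H$ denotes reduced homology. For a face $F\in\Delta$: the link is $\operatorname{lk}(F,\Delta)=\{T\in\Delta: T\cap F=\emptyset,\ T\cup F\in\Delta\}$ and the (closed) antistar is $\operatorname{ast}(F,\Delta)=\{T\in\Delta: F\not\subseteq T\}$. -}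

module Defs where

open import Data.Nat using (ℕ; zero; suc; _≤_; _<_; _∸_; _<ᵇ_)
open import Data.Bool using (Bool; true; false; if_then_else_; _∧_)
open import Data.Fin using (Fin; toℕ)
import Data.Fin as Fin
open import Data.Fin.Subset using (Subset; _∈_; _∉_; _⊆_; _⊂_; _∪_; ⁅_⁆; ∣_∣)
open import Data.Vec using (lookup)
open import Data.Integer as ℤ using (ℤ; 0ℤ; 1ℤ; -_; _+_; _*_)
open import Data.Product using (Σ; _×_; ∃)
open import Relation.Nullary using (¬_)
open import Relation.Binary.PropositionalEquality using (_≡_; _≢_)

Family : ℕ → Set₁
Family V = Subset V → Set

IsSimplicialComplex : ∀ {V} → Family V → Set
IsSimplicialComplex {V} Δ = ∀ (F G : Subset V) → G ⊆ F → Δ F → Δ G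

HasDim : ∀ {V} → Family V → ℕ → Set
HasDim {V} Δ d = (Σ (Subset V) λ F → Δ F × ∣ F ∣ ≡ suc d)
               × (∀ (F : Subset V) → Δ F → ∣ F ∣ ≤ suc d)

IsMissingFace : ∀ {V} → Family V → Subset V → Set
IsMissingFace {V} Δ F = ¬ Δ F × (∀ (G : Subset V) → G ⊂ F → Δ G)

NoMissingFacesAbove : ∀ {V} → Family V → ℕ → Set
NoMissingFacesAbove {V} Δ i = ∀ (F : Subset V) → IsMissingFace Δ F → ∣ F ∣ ≤ suc i

lk : ∀ {V} → Subset V → Family V → Family V
lk F Δ T = Δ T × (∀ x → x ∈ T → x ∉ F) × Δ (T ∪ F)

ast : ∀ {V} → Subset V → Family V → Family V
ast F Δ T = Δ T × ¬ (F ⊆ T)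

-- A chain is a function Subset V → ℤ; an "n-chain" (n = k+1, k the
-- homological degree, so n = 0 is degree -1 generated by the empty face)
-- is supported on faces of Δ with exactly n vertices.
-- Orientation: faces are ordered by the natural order of Fin V.

sumFin : ∀ {m} → (Fin m → ℤ) → ℤ
sumFin {zero}  f = 0ℤ
sumFin {suc m} f = f Fin.zero + sumFin (λ j → f (Fin.suc j))

countℕ : ∀ {m} → (Fin m → Bool) → ℕ
countℕ {zero}  f = zero
countℕ {suc m} f = if f Fin.zero then suc (countℕ (λ j → f (Fin.suc j))) else countℕ (λ j → f (Fin.suc j))

negPow : ℕ → ℤ
negPow zero    = 1ℤ
negPow (suc k) = - negPow k

sign : ∀ {V} → Subset V → Fin V → ℤ
sign G v = negPow (countℕ (λ u → lookup G u ∧ (toℕ u <ᵇ toℕ v)))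

∂ : ∀ {V} → (Subset V → ℤ) → Subset V → ℤ
∂ c G = sumFin (λ v → if lookup G v then 0ℤ else sign G v * c (G ∪ ⁅ v ⁆))

IsChain : ∀ {V} → Family V → ℕ → (Subset V → ℤ) → Set
IsChain Δ n c = ∀ G → c G ≢ 0ℤ → Δ G × ∣ G ∣ ≡ n

IsCycle : ∀ {V} → (Subset V → ℤ) → Set
IsCycle c = ∀ G → ∂ c G ≡ 0ℤ

IsBoundary : ∀ {V} → Family V → ℕ → (Subset V → ℤ) → Set
IsBoundary {V} Δ n z = Σ (Subset V → ℤ) λ b → IsChain Δ (suc n) b × (∀ G → z G ≡ ∂ b G)

-- H̃_{n-1}(Δ; ℤ) = 0 : every (n-1)-cycle is a boundary.
-- (n = 0 corresponds to reduced homology in degree -1.)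
ReducedHomologyVanishes : ∀ {V} → Family V → ℕ → Set
ReducedHomologyVanishes Δ n = ∀ z → IsChain Δ n z → IsCycle z → IsBoundary Δ n z

-- Contract a top-dimensional cycle z of Δ against F: T ↦ ± z (T ∪ F) is a cycle
-- of lk F in its top degree d − |F|.  A top-degree cycle that is a boundary is
-- zero (there are no larger faces to bound), so if H̃_{d−|F|}(lk F) = 0 then z
-- vanishes on every face containing F, i.e. z is a cycle of ast F.  If moreover
-- H̃_d(ast F) = 0, then z bounds in ast F ⊆ Δ, whence H̃_d(Δ) = 0.
module Submission where

open import Defs
open import Data.Nat using (ℕ; zero; suc; _+_; _∸_; _≤_; _<_; _<ᵇ_)
open import Data.Nat.Properties using (+-suc; m+n∸n≡m; m+n≤o⇒m≤o∸n; 1+n≰n)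
open import Data.Bool using (Bool; true; false; if_then_else_; _∧_; _∨_)
open import Data.Bool.Properties using (∨-identityʳ; ∧-distribʳ-∨)
open import Data.Fin using (Fin; toℕ; zero; suc)
open import Data.Fin.Subset using (Subset; ∣_∣; _∈_; _∉_; _⊆_; _∪_; _─_; ⁅_⁆; inside; outside)
open import Data.Fin.Subset.Properties
  using (_∈?_; x∈⁅x⁆; x∈⁅y⁆⇒x≡y; x∈p∪q⁻; p⊆p∪q; q⊆p∪q; drop-∷-⊆; ∪-identityʳ; ∪-commutativeMonoid)
open import Data.Fin.Properties using (all?)
open import Algebra.Bundles using (CommutativeMonoid)
import Algebra.Properties.CommutativeSemigroup as CommutativeSemigroupProperties
open import Data.Vec using ([]; _∷_; lookup; here; there)
open import Data.Vec.Properties using ([]=⇒lookup; lookup⇒[]=; lookup-zipWith)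
open import Data.Integer using (ℤ; 0ℤ; 1ℤ; -_; _*_)
import Data.Integer as ℤ
open import Data.Integer.Properties using (*-zeroʳ; *-identityˡ; *-assoc; *-distribˡ-+; neg-distribˡ-*)
open import Data.Integer.Tactic.RingSolver using (solve-∀)
open import Data.Product using (_,_; proj₁; proj₂)
open import Data.Sum using (inj₁; inj₂)
open import Data.Empty using (⊥-elim)
open import Function using (_∘_)
open import Relation.Nullary using (¬_; Dec; yes; no)
open import Relation.Nullary.Decidable using (¬?; _→-dec_)
open import Relation.Binary.PropositionalEquality
open ≡-Reasoning

private variable
  m n : ℕ

Disjoint : Subset n → Subset n → Set
Disjoint p q = ∀ x → x ∈ p → x ∉ q

disjoint? : (p q : Subset n) → Dec (Disjoint p q)
disjoint? p q = all? λ x → x ∈? p →-dec ¬? (x ∈? q)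

Disjoint-antitoneˡ : {p p′ q : Subset n} → p ⊆ p′ → Disjoint p′ q → Disjoint p q
Disjoint-antitoneˡ p⊆p′ disj x x∈p = disj x (p⊆p′ x∈p)

Disjoint-∪⁅⁆ : {p q : Subset n} {x : Fin n} → Disjoint p q → x ∉ q → Disjoint (p ∪ ⁅ x ⁆) q
Disjoint-∪⁅⁆ {p = p} {q} {x} disj x∉q y y∈p∪x y∈q with x∈p∪q⁻ p ⁅ x ⁆ y∈p∪x
... | inj₁ y∈p   = disj y y∈p y∈q
... | inj₂ y∈⁅x⁆ = x∉q (subst (_∈ q) (x∈⁅y⁆⇒x≡y x y∈⁅x⁆) y∈q)

¬Disjoint-∪⁅⁆ : {p q : Subset n} {x : Fin n} → x ∈ q → ¬ Disjoint (p ∪ ⁅ x ⁆) q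
¬Disjoint-∪⁅⁆ {p = p} {x = x} x∈q disj = disj x (q⊆p∪q p ⁅ x ⁆ (x∈⁅x⁆ x)) x∈q

Disjoint-tail : {s t : Bool} {p q : Subset n} → Disjoint (s ∷ p) (t ∷ q) → Disjoint p q
Disjoint-tail disj x x∈p x∈q = disj (suc x) (there x∈p) (there x∈q)

∣∪∣-disjoint : (p q : Subset n) → Disjoint p q → ∣ p ∪ q ∣ ≡ ∣ p ∣ + ∣ q ∣
∣∪∣-disjoint []            []            _    = refl
∣∪∣-disjoint (inside ∷ p)  (inside ∷ q)  disj = ⊥-elim (disj zero here here)
∣∪∣-disjoint (inside ∷ p)  (outside ∷ q) disj = cong suc (∣∪∣-disjoint p q (Disjoint-tail disj))
∣∪∣-disjoint (outside ∷ p) (inside ∷ q)  disj =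
  trans (cong suc (∣∪∣-disjoint p q (Disjoint-tail disj))) (sym (+-suc ∣ p ∣ ∣ q ∣))
∣∪∣-disjoint (outside ∷ p) (outside ∷ q) disj = ∣∪∣-disjoint p q (Disjoint-tail disj)

Disjoint-─ : (p q : Subset n) → Disjoint (p ─ q) q
Disjoint-─ (_ ∷ p) (_ ∷ q)       (suc x) (there x∈p─q) (there x∈q) = Disjoint-─ p q x x∈p─q x∈q
Disjoint-─ (_ ∷ p) (inside ∷ q)  zero    ()            _
Disjoint-─ (_ ∷ p) (outside ∷ q) zero    _             ()

─-∪-cancel : (p q : Subset n) → q ⊆ p → (p ─ q) ∪ q ≡ p
─-∪-cancel []      []            _   = refl
─-∪-cancel (s ∷ p) (inside ∷ q)  q⊆p with q⊆p here
... | here = cong (inside ∷_) (─-∪-cancel p q (drop-∷-⊆ q⊆p))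
─-∪-cancel (s ∷ p) (outside ∷ q) q⊆p = cong₂ _∷_ (∨-identityʳ s) (─-∪-cancel p q (drop-∷-⊆ q⊆p))

lookup≡false⇒∉ : {p : Subset n} {x : Fin n} → lookup p x ≡ false → x ∉ p
lookup≡false⇒∉ p[x]≡false x∈p with trans (sym ([]=⇒lookup x∈p)) p[x]≡false
... | ()

negPow-+ : ∀ a b → negPow (a + b) ≡ negPow a * negPow b
negPow-+ zero    b = sym (*-identityˡ (negPow b))
negPow-+ (suc a) b = trans (cong -_ (negPow-+ a b)) (neg-distribˡ-* (negPow a) (negPow b))

negPow-square : ∀ a → negPow a * negPow a ≡ 1ℤ
negPow-square zero    = refl
negPow-square (suc a) = trans (neg*neg (negPow a)) (negPow-square a)
  where
  neg*neg : ∀ x → (- x) * (- x) ≡ x * x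
  neg*neg = solve-∀

countℕ-cong : (f g : Fin m → Bool) → (∀ u → f u ≡ g u) → countℕ f ≡ countℕ g
countℕ-cong {zero}  f g f≗g = refl
countℕ-cong {suc m} f g f≗g rewrite f≗g zero = cong (λ k → if g zero then suc k else k)
  (countℕ-cong (f ∘ suc) (g ∘ suc) (f≗g ∘ suc))

countℕ-∨ : (f g : Fin m → Bool) → (∀ u → f u ∧ g u ≡ false)
  → countℕ (λ u → f u ∨ g u) ≡ countℕ f + countℕ g
countℕ-∨ {zero}  f g _ = refl
countℕ-∨ {suc m} f g disj with f zero | g zero | disj zero | countℕ-∨ (f ∘ suc) (g ∘ suc) (disj ∘ suc)
... | true  | true  | ()  | _
... | true  | false | _   | ih = cong suc ih
... | false | true  | _   | ih = trans (cong suc ih) (sym (+-suc _ _))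
... | false | false | _   | ih = ih

sign-∪ : (G F : Subset n) (v : Fin n) → Disjoint G F → sign (G ∪ F) v ≡ sign G v * sign F v
sign-∪ G F v disj = begin
  negPow (countℕ (λ u → lookup (G ∪ F) u ∧ below u))
    ≡⟨ cong negPow (countℕ-cong _ _ split) ⟩
  negPow (countℕ (λ u → (lookup G u ∧ below u) ∨ (lookup F u ∧ below u)))
    ≡⟨ cong negPow (countℕ-∨ _ _ disjoint-below) ⟩
  negPow (countBelow G + countBelow F)
    ≡⟨ negPow-+ (countBelow G) (countBelow F) ⟩
  sign G v * sign F v ∎
  where
  below : Fin _ → Bool
  below u = toℕ u <ᵇ toℕ v
  countBelow : Subset _ → ℕ
  countBelow X = countℕ (λ u → lookup X u ∧ below u)
  split : ∀ u → lookup (G ∪ F) u ∧ below u ≡ (lookup G u ∧ below u) ∨ (lookup F u ∧ below u)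
  split u = trans (cong (_∧ below u) (lookup-zipWith _∨_ u G F)) (∧-distribʳ-∨ (below u) (lookup G u) (lookup F u))
  disjoint-below : ∀ u → (lookup G u ∧ below u) ∧ (lookup F u ∧ below u) ≡ false
  disjoint-below u with lookup G u in G[u] | lookup F u in F[u] | below u
  ... | true  | true  | _     = ⊥-elim (disj u (lookup⇒[]= u G G[u]) (lookup⇒[]= u F F[u]))
  ... | true  | false | true  = refl
  ... | true  | false | false = refl
  ... | false | _     | _     = refl

sign-square : (G : Subset n) (v : Fin n) → sign G v * sign G v ≡ 1ℤ
sign-square G v = negPow-square (countℕ (λ u → lookup G u ∧ (toℕ u <ᵇ toℕ v)))

∏ : Subset n → (Fin n → ℤ) → ℤ
∏ []            s = 1ℤ
∏ (inside ∷ T)  s = s zero * ∏ T (s ∘ suc)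
∏ (outside ∷ T) s = ∏ T (s ∘ suc)

∏-insert : (T : Subset n) (s : Fin n → ℤ) {v : Fin n} → v ∉ T → ∏ (T ∪ ⁅ v ⁆) s ≡ s v * ∏ T s
∏-insert (inside ∷ T)  s {zero}  v∉T = ⊥-elim (v∉T here)
∏-insert (outside ∷ T) s {zero}  _   = cong (λ U → s zero * ∏ U (s ∘ suc)) (∪-identityʳ T)
∏-insert (inside ∷ T)  s {suc v} v∉T = begin
  s zero * ∏ (T ∪ ⁅ v ⁆) (s ∘ suc)       ≡⟨ cong (s zero *_) (∏-insert T (s ∘ suc) (v∉T ∘ there)) ⟩
  s zero * (s (suc v) * ∏ T (s ∘ suc))   ≡⟨ x*[y*z]≡y*[x*z] (s zero) (s (suc v)) _ ⟩
  s (suc v) * (s zero * ∏ T (s ∘ suc))   ∎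
  where
  x*[y*z]≡y*[x*z] : ∀ x y z → x * (y * z) ≡ y * (x * z)
  x*[y*z]≡y*[x*z] = solve-∀
∏-insert (outside ∷ T) s {suc v} v∉T = ∏-insert T (s ∘ suc) (v∉T ∘ there)

∏-square : (T : Subset n) (s : Fin n → ℤ) → (∀ u → s u * s u ≡ 1ℤ) → ∏ T s * ∏ T s ≡ 1ℤ
∏-square []            s _  = refl
∏-square (inside ∷ T)  s s² = begin
  (s zero * ∏ T (s ∘ suc)) * (s zero * ∏ T (s ∘ suc))     ≡⟨ [x*y]*[x*y]≡[x*x]*[y*y] (s zero) _ ⟩
  (s zero * s zero) * (∏ T (s ∘ suc) * ∏ T (s ∘ suc))     ≡⟨ cong₂ _*_ (s² zero) (∏-square T (s ∘ suc) (s² ∘ suc)) ⟩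
  1ℤ ∎
  where
  [x*y]*[x*y]≡[x*x]*[y*y] : ∀ x y → (x * y) * (x * y) ≡ (x * x) * (y * y)
  [x*y]*[x*y]≡[x*x]*[y*y] = solve-∀
∏-square (outside ∷ T) s s² = ∏-square T (s ∘ suc) (s² ∘ suc)

sumFin-zero : (f : Fin m → ℤ) → (∀ v → f v ≡ 0ℤ) → sumFin f ≡ 0ℤ
sumFin-zero {zero}  f f≗0 = refl
sumFin-zero {suc m} f f≗0 = cong₂ ℤ._+_ (f≗0 zero) (sumFin-zero (f ∘ suc) (f≗0 ∘ suc))

sumFin-*ˡ : (c : ℤ) (f : Fin m → ℤ) → sumFin (λ v → c * f v) ≡ c * sumFin f
sumFin-*ˡ {zero}  c f = sym (*-zeroʳ c)
sumFin-*ˡ {suc m} c f =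
  trans (cong₂ ℤ._+_ (refl {x = c * f zero}) (sumFin-*ˡ c (f ∘ suc))) (sym (*-distribˡ-+ c (f zero) (sumFin (f ∘ suc))))

sumFin-cong : (f g : Fin m → ℤ) → (∀ v → f v ≡ g v) → sumFin f ≡ sumFin g
sumFin-cong {zero}  f g f≗g = refl
sumFin-cong {suc m} f g f≗g = cong₂ ℤ._+_ (f≗g zero) (sumFin-cong (f ∘ suc) (g ∘ suc) (f≗g ∘ suc))

∂-summand : (Subset n → ℤ) → Subset n → Fin n → ℤ
∂-summand c G v = if lookup G v then 0ℤ else sign G v * c (G ∪ ⁅ v ⁆)

∂-vanishes : (c : Subset n → ℤ) (G : Subset n) → (∀ v → v ∉ G → c (G ∪ ⁅ v ⁆) ≡ 0ℤ) → ∂ c G ≡ 0ℤ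
∂-vanishes c G c≡0 = sumFin-zero (∂-summand c G) summand≡0
  where
  summand≡0 : ∀ v → ∂-summand c G v ≡ 0ℤ
  summand≡0 v with lookup G v in G[v]
  ... | true  = refl
  ... | false = trans (cong (sign G v *_) (c≡0 v (lookup≡false⇒∉ G[v]))) (*-zeroʳ (sign G v))

IsBoundary-mono : {Δ₁ Δ₂ : Family n} {k : ℕ} {z : Subset n → ℤ}
  → (∀ G → Δ₁ G → Δ₂ G) → IsBoundary Δ₁ k z → IsBoundary Δ₂ k z
IsBoundary-mono Δ₁⊆Δ₂ (b , b-chain , z≡∂b) =
  b , (λ G b≢0 → let (ΔG , ∣G∣) = b-chain G b≢0 in Δ₁⊆Δ₂ G ΔG , ∣G∣) , z≡∂b

boundary-vanishes-at-top : {Δ : Family n} {k : ℕ} {z : Subset n → ℤ}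
  → (∀ G → Δ G → ∣ G ∣ ≤ k) → IsBoundary Δ k z → ∀ G → z G ≡ 0ℤ
boundary-vanishes-at-top {k = k} dim (b , b-chain , z≡∂b) G =
  trans (z≡∂b G) (∂-vanishes b G (λ v _ → b≡0 (G ∪ ⁅ v ⁆)))
  where
  b≡0 : ∀ H → b H ≡ 0ℤ
  b≡0 H with b H ℤ.≟ 0ℤ
  ... | yes b≡0 = b≡0
  ... | no  b≢0 = let (ΔH , ∣H∣≡1+k) = b-chain H b≢0 in
                  ⊥-elim (1+n≰n (subst (_≤ k) ∣H∣≡1+k (dim H ΔH)))

cycle-vanishes-at-top : {Δ : Family n} {k : ℕ} {z : Subset n → ℤ}
  → (∀ G → Δ G → ∣ G ∣ ≤ k) → ReducedHomologyVanishes Δ k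
  → IsChain Δ k z → IsCycle z → ∀ G → z G ≡ 0ℤ
cycle-vanishes-at-top dim H̃≡0 z-chain z-cycle =
  boundary-vanishes-at-top dim (H̃≡0 _ z-chain z-cycle)

lk-dimension : {Δ : Family n} {k : ℕ} (F : Subset n)
  → (∀ G → Δ G → ∣ G ∣ ≤ k) → ∀ T → lk F Δ T → ∣ T ∣ ≤ k ∸ ∣ F ∣
lk-dimension {k = k} F dim T (_ , T#F , Δ[T∪F]) =
  m+n≤o⇒m≤o∸n ∣ T ∣ (subst (_≤ k) (∣∪∣-disjoint T F T#F) (dim (T ∪ F) Δ[T∪F]))

-- (−1)^#{(f, t) ∈ F × T : f < t}: the sign by which the ordered face T ∪ F differs
-- from T followed by F.  It makes linkProjection F commute with ∂ up to sign.
linkSign : Subset n → Subset n → ℤ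
linkSign F T = ∏ T (sign F)

linkSign-square : (F T : Subset n) → linkSign F T * linkSign F T ≡ 1ℤ
linkSign-square F T = ∏-square T (sign F) (sign-square F)

linkProjection : Subset n → (Subset n → ℤ) → Subset n → ℤ
linkProjection F z T with disjoint? T F
... | yes _ = linkSign F T * z (T ∪ F)
... | no  _ = 0ℤ

module _ {F : Subset n} {z : Subset n → ℤ} where

  linkProjection-disjoint : ∀ {T} → Disjoint T F → linkProjection F z T ≡ linkSign F T * z (T ∪ F)
  linkProjection-disjoint {T} T#F with disjoint? T F
  ... | yes _   = refl
  ... | no ¬T#F = ⊥-elim (¬T#F T#F)

  linkProjection-overlap : ∀ {T} → ¬ Disjoint T F → linkProjection F z T ≡ 0ℤ
  linkProjection-overlap {T} ¬T#F with disjoint? T F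
  ... | yes T#F = ⊥-elim (¬T#F T#F)
  ... | no _    = refl

  linkProjection-isChain : {Δ : Family n} {k : ℕ} → IsSimplicialComplex Δ
    → IsChain Δ k z → IsChain (lk F Δ) (k ∸ ∣ F ∣) (linkProjection F z)
  linkProjection-isChain {Δ} {k} closed z-chain T π≢0 with disjoint? T F
  ... | no _    = ⊥-elim (π≢0 refl)
  ... | yes T#F = (closed (T ∪ F) T (p⊆p∪q F) Δ[T∪F] , T#F , Δ[T∪F]) , ∣T∣≡k∸∣F∣
    where
    z≢0 : z (T ∪ F) ≢ 0ℤ
    z≢0 z≡0 = π≢0 (trans (cong (linkSign F T *_) z≡0) (*-zeroʳ (linkSign F T)))
    Δ[T∪F] : Δ (T ∪ F)
    Δ[T∪F] = proj₁ (z-chain (T ∪ F) z≢0)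
    ∣T∣≡k∸∣F∣ : ∣ T ∣ ≡ k ∸ ∣ F ∣
    ∣T∣≡k∸∣F∣ = begin
      ∣ T ∣               ≡⟨ m+n∸n≡m ∣ T ∣ ∣ F ∣ ⟨
      ∣ T ∣ + ∣ F ∣ ∸ ∣ F ∣ ≡⟨ cong (_∸ ∣ F ∣) (∣∪∣-disjoint T F T#F) ⟨
      ∣ T ∪ F ∣ ∸ ∣ F ∣     ≡⟨ cong (_∸ ∣ F ∣) (proj₂ (z-chain (T ∪ F) z≢0)) ⟩
      k ∸ ∣ F ∣           ∎

  ∂-linkProjection : ∀ {G} → Disjoint G F → ∂ (linkProjection F z) G ≡ linkSign F G * ∂ z (G ∪ F)
  ∂-linkProjection {G} G#F =
    trans (sumFin-cong _ _ summand) (sumFin-*ˡ (linkSign F G) (∂-summand z (G ∪ F)))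
    where
    summand : ∀ v → ∂-summand (linkProjection F z) G v ≡ linkSign F G * ∂-summand z (G ∪ F) v
    summand v rewrite lookup-zipWith _∨_ v G F with lookup G v in G[v] | lookup F v in F[v]
    ... | true  | _     = sym (*-zeroʳ (linkSign F G))
    ... | false | true  = begin
      sign G v * linkProjection F z (G ∪ ⁅ v ⁆)
        ≡⟨ cong (sign G v *_) (linkProjection-overlap (¬Disjoint-∪⁅⁆ (lookup⇒[]= v F F[v]))) ⟩
      sign G v * 0ℤ   ≡⟨ *-zeroʳ (sign G v) ⟩
      0ℤ              ≡⟨ *-zeroʳ (linkSign F G) ⟨
      linkSign F G * 0ℤ ∎
    ... | false | false = begin
      sign G v * linkProjection F z (G ∪ ⁅ v ⁆)
        ≡⟨ cong (sign G v *_) (linkProjection-disjoint (Disjoint-∪⁅⁆ G#F (lookup≡false⇒∉ F[v]))) ⟩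
      sign G v * (linkSign F (G ∪ ⁅ v ⁆) * z ((G ∪ ⁅ v ⁆) ∪ F))
        ≡⟨ cong (sign G v *_) (cong₂ _*_ (∏-insert G (sign F) (lookup≡false⇒∉ G[v])) (cong z (xy∙z≈xz∙y G ⁅ v ⁆ F))) ⟩
      sign G v * ((sign F v * linkSign F G) * z ((G ∪ F) ∪ ⁅ v ⁆))
        ≡⟨ rearrange (sign G v) (sign F v) (linkSign F G) _ ⟩
      linkSign F G * ((sign G v * sign F v) * z ((G ∪ F) ∪ ⁅ v ⁆))
        ≡⟨ cong (λ s → linkSign F G * (s * z ((G ∪ F) ∪ ⁅ v ⁆))) (sign-∪ G F v G#F) ⟨
      linkSign F G * (sign (G ∪ F) v * z ((G ∪ F) ∪ ⁅ v ⁆)) ∎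
      where
      open CommutativeSemigroupProperties (CommutativeMonoid.commutativeSemigroup (∪-commutativeMonoid n))
        using (xy∙z≈xz∙y)
      rearrange : ∀ a b e x → a * ((b * e) * x) ≡ e * ((a * b) * x)
      rearrange = solve-∀

  linkProjection-isCycle : IsCycle z → IsCycle (linkProjection F z)
  linkProjection-isCycle z-cycle G with disjoint? G F
  ... | yes G#F = begin
    ∂ (linkProjection F z) G     ≡⟨ ∂-linkProjection G#F ⟩
    linkSign F G * ∂ z (G ∪ F)   ≡⟨ cong (linkSign F G *_) (z-cycle (G ∪ F)) ⟩
    linkSign F G * 0ℤ            ≡⟨ *-zeroʳ (linkSign F G) ⟩
    0ℤ                           ∎
  ... | no ¬G#F = ∂-vanishes (linkProjection F z) G λ v _ →
          linkProjection-overlap (λ G∪v#F → ¬G#F (Disjoint-antitoneˡ (p⊆p∪q ⁅ v ⁆) G∪v#F))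

  linkProjection-─ : ∀ {G} → F ⊆ G → linkSign F (G ─ F) * linkProjection F z (G ─ F) ≡ z G
  linkProjection-─ {G} F⊆G = begin
    s * linkProjection F z (G ─ F)  ≡⟨ cong (s *_) (linkProjection-disjoint (Disjoint-─ G F)) ⟩
    s * (s * z ((G ─ F) ∪ F))      ≡⟨ *-assoc s s _ ⟨
    (s * s) * z ((G ─ F) ∪ F)      ≡⟨ cong₂ _*_ (linkSign-square F (G ─ F)) (cong z (─-∪-cancel G F F⊆G)) ⟩
    1ℤ * z G                       ≡⟨ *-identityˡ (z G) ⟩
    z G                            ∎
    where
    s = linkSign F (G ─ F)

  star-vanishes : (∀ T → linkProjection F z T ≡ 0ℤ) → ∀ G → F ⊆ G → z G ≡ 0ℤ
  star-vanishes π≡0 G F⊆G = begin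
    z G                                                   ≡⟨ linkProjection-─ F⊆G ⟨
    linkSign F (G ─ F) * linkProjection F z (G ─ F)       ≡⟨ cong (linkSign F (G ─ F) *_) (π≡0 (G ─ F)) ⟩
    linkSign F (G ─ F) * 0ℤ                               ≡⟨ *-zeroʳ (linkSign F (G ─ F)) ⟩
    0ℤ                                                    ∎

  ast-isChain : {Δ : Family n} {k : ℕ} → IsChain Δ k z
    → (∀ G → F ⊆ G → z G ≡ 0ℤ) → IsChain (ast F Δ) k z
  ast-isChain z-chain star≡0 G z≢0 =
    (proj₁ (z-chain G z≢0) , λ F⊆G → z≢0 (star≡0 G F⊆G)) , proj₂ (z-chain G z≢0)

lemma2p2 : (V d i : ℕ) → 0 < i → i ≤ suc d → (Δ : Family V) → IsSimplicialComplex Δ → HasDim Δ d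
    → ¬ ReducedHomologyVanishes Δ (suc d) → NoMissingFacesAbove Δ i
    → (F : Subset V) → Δ F → ReducedHomologyVanishes (ast F Δ) (suc d)
    → ¬ ReducedHomologyVanishes (lk F Δ) (suc d ∸ ∣ F ∣)
lemma2p2 V d i _ _ Δ closed (_ , dim) H̃Δ≢0 _ F _ H̃ast≡0 H̃lk≡0 = H̃Δ≢0 λ z z-chain z-cycle →
  let π≡0 = cycle-vanishes-at-top (lk-dimension F dim) H̃lk≡0
              (linkProjection-isChain closed z-chain) (linkProjection-isCycle z-cycle)
      z-ast = ast-isChain z-chain (star-vanishes π≡0)
  in IsBoundary-mono (λ _ → proj₁) (H̃ast≡0 z z-ast z-cycle)
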